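{- Let $s\le s'$ be natural numbers. Then $\textnormal{ASI}(s')\subseteq \textnormal{ASI}(s)$ and $\textnormal{ASI}_c(s')\subseteq\textnormal{ASI}_c(s)$.
   Context: All graphs are locally finite. HF denotes the set of hereditarily finite sets. A structured graph is a structure in a finite language extending the language of graphs (one binary adjacency relation, interpreted symmetrically and irreflexively). A coloring problem $(\Pi,\Gamma)$ consists of a class $\Gamma$ of structured graphs, closed under isomorphism and such that $G\in\Gamma$ iff every connected component of $G$ is in $\Gamma$, and a class $\Pi$ of functions $V(G)\to\textnormal{HF}$ ($G\in\Gamma$), closed under pushforward by isomorphisms and such that $c\in\Pi$ iff its restriction to each component is in $\Pi$. An ASI-$s$ algorithm is a function $\mathcal{A}$ which, on input $(H,<,U_0,\dots,U_s,C)$ where $H$ is a finite structured graph, $<$ a linear order on $V(H)$, $U_0,\dots,U_s$ a partition of $V(H)$, and $C\subseteq V(H)$, returns a function $C\to\textnormal{HF}$, such that for any isomorphism $\phi$ of such input structures, $\mathcal{A}(\text{input})=\mathcal{A}(\phi(\text{input}))\circ(\phi\upharpoonright C)$. It is computable if it is computable as a function on (canonical HF codes of) its inputs. For a structured graph $G$ with path metric $\rho_G$ and $r\in\omega$, $G^r$ is the graph on $V(G)$ joining distinct $x,y$ with $\rho_G(x,y)\le r$. An ASI-$s$ witness for $G$ with scale $r$ is a partition $U_0,\dots,U_s$ of $V(G)$ such that every connected component of each $G^r\upharpoonright U_i$ is finite. Given such a witness and a linear order $<$ on $V(G)$, let $\mathcal{C}$ be the disjoint set of all components of all $G^r\upharpoonright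 U_i$, and $\tilde G$ the graph on $\mathcal{C}$ joining $C\neq D$ when $\rho_G(C,D)\le r$. For $n\in\omega$, $\mathcal{A}_n[(G,<,U_0,\dots,U_s)]$ colors each $C\in\mathcal{C}$ by $\mathcal{A}(G\upharpoonright W,<\upharpoonright W,U_0\cap W,\dots,U_s\cap W,C)$, where $W=\bigcup\{D\in\mathcal{C}:\rho_{\tilde G}(C,D)\le n\}$. $\mathcal{A}$ solves $(\Pi,\Gamma)$ in $n$ stages with scale $r$ if for every $G\in\Gamma$, every linear order $<$ on $V(G)$ and every ASI-$s$ witness for $G$ with scale $r$, the resulting coloring is in $\Pi$. $(\Pi,\Gamma)\in\textnormal{ASI}(s)$ if some ASI-$s$ algorithm solves it in some number of stages with some scale; $(\Pi,\Gamma)\in\textnormal{ASI}_c(s)$ if moreover the algorithm can be taken computable. -}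

module Defs where

open import Level using (Level; _⊔_) renaming (suc to lsuc; zero to lzero)
open import Data.Nat using (ℕ; zero; suc; _+_; _*_; _∸_; _^_; _≤_; _<_)
open import Data.Bool using (Bool; true; false)
open import Data.Fin using (Fin; toℕ)
open import Data.List using (List; []; _∷_; map; concatMap; allFin; length; lookup)
open import Data.Vec using (Vec; []; _∷_)
import Data.Vec as Vec
open import Data.Product using (Σ; _×_; _,_; ∃; ∃-syntax)
open import Data.Sum using (_⊎_)
open import Relation.Nullary using (¬_)
open import Relation.Binary.PropositionalEquality using (_≡_; _≢_)
open import Relation.Binary.Construct.Closure.ReflexiveTransitive using (Star)
open import Data.List.Membership.Propositional using (_∈_)
open import Function.Bundles using (_⇔_)

-- Hereditarily finite sets.
-- HF is represented by ℕ via the Ackermann bijection (x ∈ y iff bit x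
-- of y is 1); a natural number is thus the canonical code of an HF set.

HF : Set
HF = ℕ

-- Languages: a finite language extending the language of graphs is
-- given by the list of arities of its extra relation symbols.

Lang : Set
Lang = List ℕ

Sym : Lang → Set
Sym L = Fin (length L)

arity : (L : Lang) → Sym L → ℕ
arity L i = lookup L i

record SGraph (L : Lang) : Set₁ where
  field
    V       : Set
    adj     : V → V → Set
    adj-sym : ∀ {x y} → adj x y → adj y x
    adj-irr : ∀ {x} → ¬ adj x x
    rel     : (i : Sym L) → Vec V (arity L i) → Set
open SGraph public

LocFin : ∀ {L} → SGraph L → Set
LocFin G = ∀ x → Σ (List (V G)) λ ns → ∀ y → (adj G x y ⇔ y ∈ ns)

record Iso {L} (G H : SGraph L) : Set where
  field
    to       : V G → V H
    from     : V H → V G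
    to-from  : ∀ y → to (from y) ≡ y
    from-to  : ∀ x → from (to x) ≡ x
    adj-pres : ∀ x y → (adj G x y ⇔ adj H (to x) (to y))
    rel-pres : ∀ i xs → (rel G i xs ⇔ rel H i (Vec.map to xs))
open Iso public

Conn : ∀ {L} (G : SGraph L) → V G → V G → Set
Conn G = Star (adj G)

-- the connected component of x, as an induced substructure
-- (the connectedness proof is irrelevant, so this is a genuine subset)
record CompV {L} (G : SGraph L) (x : V G) : Set where
  constructor ⟨_,_⟩
  field
    val   : V G
    .conn : Conn G x val
open CompV public

Component : ∀ {L} (G : SGraph L) → V G → SGraph L
Component G x = record
  { V       = CompV G x
  ; adj     = λ a b → adj G (val a) (val b)
  ; adj-sym = adj-sym G
  ; adj-irr = adj-irr G
  ; rel     = λ i xs → rel G i (Vec.map val xs)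
  }

record ColoringProblem (L : Lang) : Set₁ where
  field
    Γ        : SGraph L → Set
    Π        : (G : SGraph L) → (V G → HF) → Set
    Γ-locfin : ∀ G → Γ G → LocFin G
    Γ-iso    : ∀ G H → Iso G H → Γ G → Γ H
    Γ-comp   : ∀ G → (Γ G ⇔ (∀ x → Γ (Component G x)))
    Π-iso    : ∀ G H → Γ G → (φ : Iso G H) → (c : V G → HF) →
               Π G c → Π H (λ y → c (from φ y))
    Π-comp   : ∀ G → Γ G → (c : V G → HF) →
               (Π G c ⇔ (∀ x → Π (Component G x) (λ a → c (val a))))
open ColoringProblem public

-- Finite inputs (H, <, U₀,…,U_s, C) with vertex set Fin n.
-- The partition U₀,…,U_s is given by the label map part : Fin n → Fin (suc s).

record FinInput (L : Lang) (s : ℕ) : Set where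
  field
    size : ℕ
    fadj  : Fin size → Fin size → Bool
    frel  : (i : Sym L) → Vec (Fin size) (arity L i) → Bool
    flt   : Fin size → Fin size → Bool
    fpart : Fin size → Fin (suc s)
    fC    : Fin size → Bool
open FinInput public

record WF {L s} (I : FinInput L s) : Set where
  field
    wf-sym   : ∀ x y → fadj I x y ≡ fadj I y x
    wf-irr   : ∀ x → fadj I x x ≡ false
    wf-ltirr : ∀ x → flt I x x ≡ false
    wf-lttr  : ∀ x y z → flt I x y ≡ true → flt I y z ≡ true → flt I x z ≡ true
    wf-lttot : ∀ x y → x ≢ y → flt I x y ≡ true ⊎ flt I y x ≡ true

record FinIso {L s} (I J : FinInput L s) : Set where
  field
    fto      : Fin (size I) → Fin (size J)
    ffrom    : Fin (size J) → Fin (size I)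
    fto-from : ∀ y → fto (ffrom y) ≡ y
    ffrom-to : ∀ x → ffrom (fto x) ≡ x
    fadj-pres  : ∀ x y → fadj I x y ≡ fadj J (fto x) (fto y)
    frel-pres  : ∀ i xs → frel I i xs ≡ frel J i (Vec.map fto xs)
    flt-pres   : ∀ x y → flt I x y ≡ flt J (fto x) (fto y)
    fpart-pres : ∀ x → fpart I x ≡ fpart J (fto x)
    fC-pres    : ∀ x → fC I x ≡ fC J (fto x)
open FinIso public

Alg : Lang → ℕ → Set
Alg L s = (I : FinInput L s) → (x : Fin (size I)) → fC I x ≡ true → HF

IsASIAlg : ∀ {L s} → Alg L s → Set
IsASIAlg {L} {s} A = ∀ (I J : FinInput L s) → WF I → WF J → (φ : FinIso I J) →
  ∀ x (p : fC I x ≡ true) (q : fC J (fto φ x) ≡ true) → A I x p ≡ A J (fto φ x) q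

data Rec : ℕ → Set where
  zeroF : ∀ {k} → Rec k
  sucF  : Rec 1
  projF : ∀ {k} → Fin k → Rec k
  compF : ∀ {k m} → Rec m → Vec (Rec k) m → Rec k
  primF : ∀ {k} → Rec k → Rec (suc (suc k)) → Rec (suc k)
  minF  : ∀ {k} → Rec (suc k) → Rec k

mutual
  data _⟨_⟩⇓_ : ∀ {k} → Rec k → Vec ℕ k → ℕ → Set where
    ev-zero  : ∀ {k} {xs : Vec ℕ k} → zeroF ⟨ xs ⟩⇓ 0
    ev-suc   : ∀ {x} → sucF ⟨ x ∷ [] ⟩⇓ suc x
    ev-proj  : ∀ {k} {i : Fin k} {xs} → projF i ⟨ xs ⟩⇓ Vec.lookup xs i
    ev-comp  : ∀ {k m} {f : Rec m} {gs : Vec (Rec k) m} {xs ys y} →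
               gs ⟨ xs ⟩⇓* ys → f ⟨ ys ⟩⇓ y → compF f gs ⟨ xs ⟩⇓ y
    ev-prim0 : ∀ {k} {f : Rec k} {g xs y} → f ⟨ xs ⟩⇓ y → primF f g ⟨ 0 ∷ xs ⟩⇓ y
    ev-primS : ∀ {k} {f : Rec k} {g xs n z y} →
               primF f g ⟨ n ∷ xs ⟩⇓ z → g ⟨ n ∷ z ∷ xs ⟩⇓ y →
               primF f g ⟨ suc n ∷ xs ⟩⇓ y
    ev-min   : ∀ {k} {f : Rec (suc k)} {xs n} → f ⟨ n ∷ xs ⟩⇓ 0 →
               (∀ m → m < n → Σ ℕ λ v → f ⟨ m ∷ xs ⟩⇓ suc v) → minF f ⟨ xs ⟩⇓ n
  data _⟨_⟩⇓*_ : ∀ {k m} → Vec (Rec k) m → Vec ℕ k → Vec ℕ m → Set where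
    []  : ∀ {k} {xs : Vec ℕ k} → [] ⟨ xs ⟩⇓* []
    _∷_ : ∀ {k m} {g : Rec k} {gs : Vec (Rec k) m} {xs y ys} →
          g ⟨ xs ⟩⇓ y → gs ⟨ xs ⟩⇓* ys → (g ∷ gs) ⟨ xs ⟩⇓* (y ∷ ys)

pair : ℕ → ℕ → ℕ
pair a b = 2 ^ a * (2 * b + 1) ∸ 1

codeList : List ℕ → ℕ
codeList []       = 0
codeList (x ∷ xs) = suc (pair x (codeList xs))

b2n : Bool → ℕ
b2n false = 0
b2n true  = 1

allVecs : (n k : ℕ) → List (Vec (Fin n) k)
allVecs n zero    = [] ∷ []
allVecs n (suc k) = concatMap (λ x → map (x ∷_) (allVecs n k)) (allFin n)

allPairs : (n : ℕ) → List (Fin n × Fin n)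
allPairs n = concatMap (λ x → map (x ,_) (allFin n)) (allFin n)

codeInput : ∀ {L s} → FinInput L s → ℕ
codeInput {L} I = codeList
  ( size I
  ∷ codeList (map (λ { (x , y) → b2n (fadj I x y) }) (allPairs (size I)))
  ∷ codeList (map (λ i → codeList (map (λ xs → b2n (frel I i xs))
                                        (allVecs (size I) (arity L i))))
                  (allFin (length L)))
  ∷ codeList (map (λ { (x , y) → b2n (flt I x y) }) (allPairs (size I)))
  ∷ codeList (map (λ x → toℕ (fpart I x)) (allFin (size I)))
  ∷ codeList (map (λ x → b2n (fC I x)) (allFin (size I)))
  ∷ [])

Computable : ∀ {L s} → Alg L s → Set
Computable {L} {s} A = Σ (Rec 1) λ e →
  ∀ (I : FinInput L s) → WF I → ∀ x (p : fC I x ≡ true) →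
  e ⟨ pair (codeInput I) (toℕ x) ∷ [] ⟩⇓ A I x p

data Walk {L} (G : SGraph L) : ℕ → V G → V G → Set where
  here : ∀ {x} → Walk G 0 x x
  step : ∀ {k x y z} → adj G x y → Walk G k y z → Walk G (suc k) x z

Dist≤ : ∀ {L} (G : SGraph L) → ℕ → V G → V G → Set
Dist≤ G r x y = ∃[ k ] (k ≤ r × Walk G k x y)

-- x,y lie in the same connected component of G^r ↾ U_i
-- (reflexive–transitive closure of the G^r edges inside one part)
SameComp : ∀ {L s} (G : SGraph L) (r : ℕ) (U : V G → Fin (suc s)) → V G → V G → Set
SameComp G r U = Star (λ a b → U a ≡ U b × a ≢ b × Dist≤ G r a b)

Witness : ∀ {L s} (G : SGraph L) (r : ℕ) (U : V G → Fin (suc s)) → Set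
Witness G r U = ∀ x → Σ (List (V G)) λ ys → ∀ y → (SameComp G r U x y ⇔ y ∈ ys)

-- adjacency-or-equality in G̃ of the components of x and z: ρ_G(C_x,C_z) ≤ r
TStep : ∀ {L s} (G : SGraph L) (r : ℕ) (U : V G → Fin (suc s)) → V G → V G → Set
TStep G r U x z = ∃[ a ] ∃[ b ] (SameComp G r U x a × SameComp G r U z b × Dist≤ G r a b)

data TChain {L s} (G : SGraph L) (r : ℕ) (U : V G → Fin (suc s)) : ℕ → V G → V G → Set where
  tnil  : ∀ {x y} → SameComp G r U x y → TChain G r U 0 x y
  tcons : ∀ {k x z y} → TStep G r U x z → TChain G r U k z y → TChain G r U (suc k) x y

-- ρ_G̃(C_x, C_y) ≤ n, i.e. y ∈ W for the component of x
Near : ∀ {L s} (G : SGraph L) (r n : ℕ) (U : V G → Fin (suc s)) → V G → V G → Set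
Near G r n U x y = ∃[ k ] (k ≤ n × TChain G r U k x y)

record LinOrder {L} (G : SGraph L) (lt : V G → V G → Set) : Set where
  field
    lo-irr : ∀ x → ¬ lt x x
    lo-tr  : ∀ {x y z} → lt x y → lt y z → lt x z
    lo-tot : ∀ x y → x ≢ y → lt x y ⊎ lt y x

-- I is (an isomorphic copy on Fin n of) the input
-- (G ↾ W, < ↾ W, U₀ ∩ W, …, U_s ∩ W, C)
record Presents {L s} (G : SGraph L) (lt : V G → V G → Set) (U : V G → Fin (suc s))
                (W Cs : V G → Set) (I : FinInput L s) : Set where
  field
    emb      : Fin (size I) → V G
    emb-inj  : ∀ i j → emb i ≡ emb j → i ≡ j
    emb-W    : ∀ i → W (emb i)
    emb-onto : ∀ v → W v → ∃[ i ] (emb i ≡ v)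
    p-adj    : ∀ i j → (adj G (emb i) (emb j) ⇔ (fadj I i j ≡ true))
    p-rel    : ∀ k xs → (rel G k (Vec.map emb xs) ⇔ (frel I k xs ≡ true))
    p-lt     : ∀ i j → (lt (emb i) (emb j) ⇔ (flt I i j ≡ true))
    p-part   : ∀ i → U (emb i) ≡ fpart I i
    p-C      : ∀ i → (Cs (emb i) ⇔ (fC I i ≡ true))
open Presents public

Result : ∀ {L s} → Alg L s → (n r : ℕ) → (G : SGraph L) → (lt : V G → V G → Set) →
         (U : V G → Fin (suc s)) → (V G → HF) → Set
Result {L} {s} A n r G lt U c = ∀ v (I : FinInput L s) →
  (P : Presents G lt U (Near G r n U v) (SameComp G r U v) I) →
  ∀ i → emb P i ≡ v → (p : fC I i ≡ true) → c v ≡ A I i p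

Solves : ∀ {L s} → Alg L s → (n r : ℕ) → ColoringProblem L → Set₁
Solves {L} {s} A n r P = ∀ (G : SGraph L) → Γ P G →
  (lt : V G → V G → Set) → LinOrder G lt →
  (U : V G → Fin (suc s)) → Witness G r U →
  (c : V G → HF) → Result A n r G lt U c → Π P G c

ASI : ∀ {L} → ℕ → ColoringProblem L → Set₁
ASI {L} s P = Σ (Alg L s) λ A → IsASIAlg A × ∃[ n ] ∃[ r ] Solves A n r P

ASIc : ∀ {L} → ℕ → ColoringProblem L → Set₁
ASIc {L} s P = Σ (Alg L s) λ A → IsASIAlg A × Computable A × ∃[ n ] ∃[ r ] Solves A n r P

-- An ASI-s witness U₀,…,U_s is also an ASI-s′ witness (with U_{s+1},…,U_{s′} empty),
-- and it has the same components at every scale, hence the same sets W and C.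
-- So running an ASI-s′ algorithm A′ on the input with its partition labels embedded
-- into Fin (suc s′) solves the same problems; isomorphism invariance of A′ makes this
-- independent of how the local picture is presented. The embedding preserves the
-- numeric value of each label, so input codes agree and the program computing A′
-- also computes the new algorithm.
module Submission where

open import Defs
open import Data.Nat using (ℕ; suc; _≤_; s≤s)
open import Data.Product using (_×_; _,_; proj₁; proj₂)
open import Data.Sum using (_⊎_; inj₁; inj₂)
open import Data.Bool using (true)
open import Data.Bool.Properties using (¬-not; ⇔→≡)
open import Data.Fin using (Fin; inject≤; toℕ)
open import Data.Fin.Properties using (toℕ-inject≤; inject≤-injective)
open import Data.List using (allFin)
open import Data.List.Properties using (map-cong)
import Data.Vec as Vec
open import Data.Vec.Properties using (map-id)
open import Function using (_∘_; id)
open import Function.Bundles using (Equivalence; mk⇔; _⇔_)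
open import Function.Definitions using (Injective)
open import Relation.Binary.PropositionalEquality
  using (_≡_; refl; sym; trans; cong; subst)
open import Relation.Binary.Construct.Closure.ReflexiveTransitive using (ε; _◅_)

open Equivalence using () renaming (to to ⇔-to; from to ⇔-from)

private
  variable
    L : Lang
    s t : ℕ

withPart : (I : FinInput L s) → (Fin (size I) → Fin (suc t)) → FinInput L t
withPart I p = record
  { size = size I ; fadj = fadj I ; frel = frel I ; flt = flt I ; fpart = p ; fC = fC I }

WF-withPart : {I : FinInput L s} (p : Fin (size I) → Fin (suc t)) → WF I → WF (withPart I p)
WF-withPart p w = record
  { wf-sym = WF.wf-sym w ; wf-irr = WF.wf-irr w ; wf-ltirr = WF.wf-ltirr w
  ; wf-lttr = WF.wf-lttr w ; wf-lttot = WF.wf-lttot w }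

FinIso-refl : (I : FinInput L s) → FinIso I I
FinIso-refl I = record
  { fto = id ; ffrom = id ; fto-from = λ _ → refl ; ffrom-to = λ _ → refl
  ; fadj-pres = λ _ _ → refl
  ; frel-pres = λ i xs → cong (frel I i) (sym (map-id xs))
  ; flt-pres = λ _ _ → refl ; fpart-pres = λ _ → refl ; fC-pres = λ _ → refl }

FinIso-withPart : {I J : FinInput L s} (φ : FinIso I J)
  (p : Fin (size I) → Fin (suc t)) (q : Fin (size J) → Fin (suc t)) →
  (∀ x → p x ≡ q (fto φ x)) → FinIso (withPart I p) (withPart J q)
FinIso-withPart φ p q p≡q∘φ = record
  { fto = fto φ ; ffrom = ffrom φ ; fto-from = fto-from φ ; ffrom-to = ffrom-to φ
  ; fadj-pres = fadj-pres φ ; frel-pres = frel-pres φ ; flt-pres = flt-pres φ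
  ; fpart-pres = p≡q∘φ ; fC-pres = fC-pres φ }

withPart-≅ : (I : FinInput L s) (p : Fin (size I) → Fin (suc s)) →
  (∀ x → p x ≡ fpart I x) → FinIso (withPart I p) I
withPart-≅ I p p≡part = FinIso-withPart (FinIso-refl I) p (fpart I) p≡part

codeInput-withPart : (I : FinInput L s) (p : Fin (size I) → Fin (suc t)) →
  (∀ x → toℕ (p x) ≡ toℕ (fpart I x)) → codeInput (withPart I p) ≡ codeInput I
codeInput-withPart I p same-code
  rewrite map-cong same-code (allFin (size I)) = refl

Presents⇒WF : {G : SGraph L} {lt : V G → V G → Set} {U : V G → Fin (suc s)}
  {W C : V G → Set} {I : FinInput L s} →
  LinOrder G lt → Presents G lt U W C I → WF I
Presents⇒WF {G = G} {lt = lt} {I = I} lo P = record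
  { wf-sym = λ x y → ⇔→≡ (mk⇔ (adj-transport x y) (adj-transport y x))
  ; wf-irr = λ x → ¬-not (adj-irr G ∘ ⇔-from (p-adj P x x))
  ; wf-ltirr = λ x → ¬-not (LinOrder.lo-irr lo _ ∘ ⇔-from (p-lt P x x))
  ; wf-lttr = λ x y z x<y y<z → ⇔-to (p-lt P x z)
      (LinOrder.lo-tr lo (⇔-from (p-lt P x y) x<y) (⇔-from (p-lt P y z) y<z))
  ; wf-lttot = λ x y x≢y → lt-total x y
      (LinOrder.lo-tot lo (emb P x) (emb P y) (x≢y ∘ emb-inj P x y))
  }
  where
  adj-transport : ∀ x y → fadj I x y ≡ true → fadj I y x ≡ true
  adj-transport x y = ⇔-to (p-adj P y x) ∘ adj-sym G ∘ ⇔-from (p-adj P x y)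

  lt-total : ∀ x y → lt (emb P x) (emb P y) ⊎ lt (emb P y) (emb P x) →
             flt I x y ≡ true ⊎ flt I y x ≡ true
  lt-total x y (inj₁ x<y) = inj₁ (⇔-to (p-lt P x y) x<y)
  lt-total x y (inj₂ y<x) = inj₂ (⇔-to (p-lt P y x) y<x)

Presents-withPart : {G : SGraph L} {lt : V G → V G → Set} {U′ : V G → Fin (suc t)}
  {W W′ C C′ : V G → Set} {I : FinInput L t} (U : V G → Fin (suc s)) →
  (∀ {v} → W v ⇔ W′ v) → (∀ {v} → C v ⇔ C′ v) →
  (P : Presents G lt U′ W′ C′ I) → Presents G lt U W C (withPart I (U ∘ emb P))
Presents-withPart U W⇔W′ C⇔C′ P = record
  { emb = emb P ; emb-inj = emb-inj P
  ; emb-W = ⇔-from W⇔W′ ∘ emb-W P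
  ; emb-onto = λ v → emb-onto P v ∘ ⇔-to W⇔W′
  ; p-adj = p-adj P ; p-rel = p-rel P ; p-lt = p-lt P
  ; p-part = λ _ → refl
  ; p-C = λ i → mk⇔ (⇔-to (p-C P i) ∘ ⇔-to C⇔C′) (⇔-from C⇔C′ ∘ ⇔-from (p-C P i))
  }

module Coarsening {G : SGraph L} (r : ℕ)
  {U₁ : V G → Fin (suc s)} {U₂ : V G → Fin (suc t)}
  (coarser : ∀ {a b} → U₁ a ≡ U₁ b → U₂ a ≡ U₂ b) where

  SameComp-coarsen : ∀ {x y} → SameComp G r U₁ x y → SameComp G r U₂ x y
  SameComp-coarsen ε = ε
  SameComp-coarsen ((same , a≢b , near) ◅ rest) =
    (coarser same , a≢b , near) ◅ SameComp-coarsen rest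

  TChain-coarsen : ∀ {k x y} → TChain G r U₁ k x y → TChain G r U₂ k x y
  TChain-coarsen (tnil xy) = tnil (SameComp-coarsen xy)
  TChain-coarsen (tcons (a , b , xa , zb , ab) chain) =
    tcons (a , b , SameComp-coarsen xa , SameComp-coarsen zb , ab) (TChain-coarsen chain)

  Near-coarsen : ∀ {n x y} → Near G r n U₁ x y → Near G r n U₂ x y
  Near-coarsen (k , k≤n , chain) = k , k≤n , TChain-coarsen chain

module Relabelling {L : Lang} {s s′ : ℕ}
  (f : Fin (suc s) → Fin (suc s′)) (f-injective : Injective _≡_ _≡_ f) where

  relabel : FinInput L s → FinInput L s′
  relabel I = withPart I (f ∘ fpart I)

  pullback : Alg L s′ → Alg L s
  pullback A′ I = A′ (relabel I)

  IsASIAlg-pullback : ∀ {A′} → IsASIAlg A′ → IsASIAlg (pullback A′)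
  IsASIAlg-pullback A′-inv I J wI wJ φ =
    A′-inv (relabel I) (relabel J) (WF-withPart _ wI) (WF-withPart _ wJ)
      (FinIso-withPart φ _ _ (cong f ∘ fpart-pres φ))

  Computable-pullback : (∀ x → toℕ (f x) ≡ toℕ x) →
    ∀ {A′} → Computable A′ → Computable (pullback A′)
  Computable-pullback f-code {A′} (e , e-computes) = e , λ I w x p →
    subst (λ code → e ⟨ pair code (toℕ x) Vec.∷ Vec.[] ⟩⇓ pullback A′ I x p)
      (codeInput-withPart I _ (f-code ∘ fpart I))
      (e-computes (relabel I) (WF-withPart _ w) x p)

  module _ {G : SGraph L} (r : ℕ) (U : V G → Fin (suc s)) where
    open Coarsening {G = G} r {U₁ = U} {U₂ = f ∘ U} (cong f) renaming
      (SameComp-coarsen to SameComp-relabel; Near-coarsen to Near-relabel)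
    open Coarsening {G = G} r {U₁ = f ∘ U} {U₂ = U} f-injective renaming
      (SameComp-coarsen to SameComp-unrelabel; Near-coarsen to Near-unrelabel)

    Witness-relabel : Witness G r U → Witness G r (f ∘ U)
    Witness-relabel wit x = proj₁ (wit x) , λ y →
      mk⇔ (⇔-to (proj₂ (wit x) y) ∘ SameComp-unrelabel)
          (SameComp-relabel ∘ ⇔-from (proj₂ (wit x) y))

    Result-pullback : ∀ {A′ n lt c} → IsASIAlg A′ → LinOrder G lt →
      Result (pullback A′) n r G lt U c → Result A′ n r G lt (f ∘ U) c
    Result-pullback {A′} {n} {lt} A′-inv lo result v I′ P′ i i↦v p =
      trans (result v I P i i↦v p)
            (A′-inv (relabel I) I′ (WF-withPart _ wf) wf
              (withPart-≅ I′ _ (p-part P′)) i p p)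
      where
      I : FinInput L s
      I = withPart I′ (U ∘ emb P′)

      P : Presents G lt U (Near G r n U v) (SameComp G r U v) I
      P = Presents-withPart U (mk⇔ Near-relabel Near-unrelabel)
                              (mk⇔ SameComp-relabel SameComp-unrelabel) P′

      wf : WF I′
      wf = Presents⇒WF lo P′

  Solves-pullback : ∀ {A′ n r P} → IsASIAlg A′ → Solves A′ n r P → Solves (pullback A′) n r P
  Solves-pullback A′-inv solves G γ lt lo U wit c result =
    solves G γ lt lo (f ∘ U) (Witness-relabel _ U wit) c (Result-pullback _ U A′-inv lo result)

module _ {L : Lang} {s s′ : ℕ} (s≤s′ : s ≤ s′) where
  open Relabelling {L} (λ x → inject≤ x (s≤s s≤s′)) (inject≤-injective _ _ _ _)

  ASI-antitone : (P : ColoringProblem L) → ASI s′ P → ASI s P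
  ASI-antitone P (A′ , A′-inv , n , r , solves) =
    pullback A′ , IsASIAlg-pullback {A′} A′-inv , n , r , Solves-pullback {A′} {n} {r} {P} A′-inv solves

  ASIc-antitone : (P : ColoringProblem L) → ASIc s′ P → ASIc s P
  ASIc-antitone P (A′ , A′-inv , computable , n , r , solves) =
    pullback A′ , IsASIAlg-pullback {A′} A′-inv ,
    Computable-pullback (λ x → toℕ-inject≤ x _) {A′} computable ,
    n , r , Solves-pullback {A′} {n} {r} {P} A′-inv solves

proposition2p6 : ∀ (L : Lang) (s s′ : ℕ) → s ≤ s′ →
    (∀ (P : ColoringProblem L) → ASI s′ P → ASI s P) ×
    (∀ (P : ColoringProblem L) → ASIc s′ P → ASIc s P)
proposition2p6 L s s′ s≤s′ = ASI-antitone s≤s′ , ASIc-antitone s≤s′
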